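{- Let $\mathcal K=\mathcal{OT}$, the class of finite ordered tournaments. Then for each $\mathbf H\in\mathcal K$ there is a structure $\overline{\mathbf H}\in\mathcal K$ containing a copy of $\mathbf H$ with the following property: for every universal inverse limit structure $\mathbf G$ for $\mathcal K$ contained in $\mathbf{F_{\max}}$ and every copy $\overline{\mathbf I}$ of $\overline{\mathbf H}$ in $\mathbf G$, the induced subtree $T_{\overline{\mathbf I}}$ of $T_{\mathbf G}$ has exactly one splitting node $t=\mathrm{stem}(T_{\overline{\mathbf I}})$; consequently the immediate successors of $\mathrm{stem}(T_{\overline{\mathbf I}})$ in $T_{\overline{\mathbf I}}$ carry a copy of $\overline{\mathbf I}$ (i.e. the induced substructure of $\mathbf{F_t}$ on $\mathrm{succ}_{T_{\overline{\mathbf I}}}(t)$ is isomorphic to $\overline{\mathbf I}$).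
   Context: $\mathcal{OT}$ consists of finite structures $\langle V,<,R\rangle$ with $<$ a linear order and $R$ an irreflexive binary relation (directed edges) such that for all distinct $x,y$ exactly one of $R(x,y)$, $R(y,x)$ holds; it is a Fra\"{\i}ss\'{e} class with Fra\"{\i}ss\'{e} limit $\mathrm{Flim}(\mathcal K)$ taken on $\omega$, and $\mathrm{Flim}(\mathcal K)_n$ is its restriction to $\{0,\dots,n\}$. Copies are induced substructures isomorphic to the given one. Trees: $\omega^{<\omega}$ with initial segment order; $|s|$; $\mathrm{succ}_T(t)$; $[T]$ branches; $x\cap y$ longest common initial segment of distinct branches; a splitting node has more than one immediate successor; $\mathrm{stem}(T)$ is the minimal splitting node. $T_{\max}$: $\mathrm{succ}_{T_{\max}}(t)=\{t^\frown\langle0\rangle,\dots,t^\frown\langle|t|\rangle\}$; fixed $\mathbf{F_t}\in\mathcal K$ on $\mathrm{succ}_{T_{\max}}(t)$ (lexicographic order) isomorphic to $\mathrm{Flim}(\mathcal K)_{|t|}$; $\mathbf{F_{\max}}$ on $[T_{\max}]$ ordered lexicographically with $(x,y)\in R$ (distinct $x,y$) iff $(x\upharpoonright(|x\cap y|+1),y\upharpoonright(|x\cap y|+1))\in R^{\mathbf{F_{x\cap y}}}$. For $\mathbf G\le\mathbf{F_{\max}}$, $T_{\mathbf G}=\{x\upharpoonright n:x\in G,n\in\omega\}$. A universal inverse limit structure for $\mathcal K$ contained in $\mathbf{F_{\max}}$ is an induced substructure $\mathbf G$ of $\mathbf{F_{\max}}$ whose universe is a closed subset of $[T_{\max}]\subseteq\omega^\omega$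 without isolated points such that every nonempty open interval of $G$ contains induced copies of all structures in $\mathcal K$. -}

module Defs where

open import Data.Nat using (ℕ; zero; suc; _≤_; _<_)
open import Data.Fin using (Fin; toℕ) renaming (_<_ to _<ᶠ_)
open import Data.Product using (Σ; ∃; ∃-syntax; Σ-syntax; _×_; _,_)
open import Data.Sum using (_⊎_)
open import Data.Maybe using (Maybe; just; nothing)
open import Data.Unit using (⊤)
open import Data.List using (List; map; upTo; length)
open import Relation.Nullary using (¬_)
open import Relation.Binary.PropositionalEquality using (_≡_; _≢_)

infix 2 _⇔_
_⇔_ : Set → Set → Set
A ⇔ B = (A → B) × (B → A)

-- Finite ordered tournaments (the class OT).
-- Universe Fin size, linear order = the standard order on Fin size
-- (every finite linear order is uniquely isomorphic to such a one).

record OT : Set₁ where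
  field
    size   : ℕ
    R      : Fin size → Fin size → Set
    irrefl : ∀ i → ¬ R i i
    asym   : ∀ i j → R i j → ¬ R j i
    total  : ∀ i j → i ≢ j → R i j ⊎ R j i
open OT public

IsEmbedding : (H H' : OT) → (Fin (size H) → Fin (size H')) → Set
IsEmbedding H H' e =
  (∀ i j → i <ᶠ j → e i <ᶠ e j) × (∀ i j → R H i j ⇔ R H' (e i) (e j))

record Strω : Set₁ where
  field
    _≺_ : ℕ → ℕ → Set
    Rω  : ℕ → ℕ → Set
open Strω public

Injective : {A B : Set} → (A → B) → Set
Injective f = ∀ x y → f x ≡ f y → x ≡ y

IsFlimOT : Strω → Set₁
IsFlimOT F =
  (∀ i → ¬ (_≺_ F i i)) ×
  (∀ i j k → _≺_ F i j → _≺_ F j k → _≺_ F i k) ×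
  (∀ i j → i ≢ j → _≺_ F i j ⊎ _≺_ F j i) ×
  (∀ i → ¬ Rω F i i) ×
  (∀ i j → Rω F i j → ¬ Rω F j i) ×
  (∀ i j → i ≢ j → Rω F i j ⊎ Rω F j i) ×
  ((H : OT) → Σ[ e ∈ (Fin (size H) → ℕ) ] ((∀ i j → i <ᶠ j → _≺_ F (e i) (e j)) ×
                      (∀ i j → R H i j ⇔ Rω F (e i) (e j)))) ×
  ((n : ℕ) (e₁ e₂ : Fin n → ℕ) → Injective e₁ → Injective e₂ →
     (∀ i j → (_≺_ F (e₁ i) (e₁ j) ⇔ _≺_ F (e₂ i) (e₂ j)) ×
              (Rω F (e₁ i) (e₁ j) ⇔ Rω F (e₂ i) (e₂ j))) →
     Σ (ℕ → ℕ) λ σ → Σ (ℕ → ℕ) λ τ →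
       (∀ x → σ (τ x) ≡ x) × (∀ x → τ (σ x) ≡ x) ×
       (∀ x y → _≺_ F x y ⇔ _≺_ F (σ x) (σ y)) ×
       (∀ x y → Rω F x y ⇔ Rω F (σ x) (σ y)) ×
       (∀ i → σ (e₁ i) ≡ e₂ i))

-- F_t : the structure on succ(t) = {t⌢0,…,t⌢m} (m = |t|), identified with
-- the last coordinates 0..m, ordered naturally (lexicographic order),
-- isomorphic to Flim_m = F restricted to {0..m}.  σ is the (unique)
-- increasing map from (Fin (m+1), natural order) onto ({0..m}, ≺).

FtR : Strω → ℕ → ℕ → ℕ → Set
FtR F m a b =
  Σ (Fin (suc m) → Fin (suc m)) λ σ →
    (∀ i j → i <ᶠ j → _≺_ F (toℕ (σ i)) (toℕ (σ j))) ×
    Σ (Fin (suc m)) λ a' → Σ (Fin (suc m)) λ b' →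
      (toℕ a' ≡ a) × (toℕ b' ≡ b) × Rω F (toℕ (σ a')) (toℕ (σ b'))

Branch : Set
Branch = ℕ → ℕ

InTmax : Branch → Set
InTmax x = ∀ k → x k ≤ k

AgreeBelow : Branch → Branch → ℕ → Set
AgreeBelow x y m = ∀ i → i < m → x i ≡ y i

MeetAt : Branch → Branch → ℕ → Set
MeetAt x y m = AgreeBelow x y m × x m ≢ y m

_<L_ : Branch → Branch → Set
x <L y = ∃[ m ] (AgreeBelow x y m × x m < y m)

FmaxR : Strω → Branch → Branch → Set
FmaxR F x y = ∃[ m ] (MeetAt x y m × FtR F m (x m) (y m))

restrict : Branch → ℕ → List ℕ
restrict x n = map x (upTo n)

ClosedInTmax : (Branch → Set) → Set
ClosedInTmax G =
  (∀ x → G x → InTmax x) ×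
  (∀ x → (∀ n → ∃[ y ] (G y × AgreeBelow x y n)) → G x)

NoIsolated : (Branch → Set) → Set
NoIsolated G =
  ∀ x → G x → ∀ n → ∃[ y ] (G y × AgreeBelow x y n × ∃[ k ] (x k ≢ y k))

CopyIn : Strω → (H : OT) → (Branch → Set) → (Fin (size H) → Branch) → Set
CopyIn F H P f =
  (∀ i → P (f i)) ×
  (∀ i j → i <ᶠ j → f i <L f j) ×
  (∀ i j → R H i j ⇔ FmaxR F (f i) (f j))

LowerOK : Maybe Branch → Branch → Set
LowerOK nothing  z = ⊤
LowerOK (just a) z = a <L z

UpperOK : Maybe Branch → Branch → Set
UpperOK nothing  z = ⊤
UpperOK (just b) z = z <L b

EndIn : (Branch → Set) → Maybe Branch → Set
EndIn G nothing  = ⊤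
EndIn G (just a) = G a

Interval : (Branch → Set) → Maybe Branch → Maybe Branch → Branch → Set
Interval G lo hi z = G z × LowerOK lo z × UpperOK hi z

UniversalILS : Strω → (Branch → Set) → Set₁
UniversalILS F G =
  ClosedInTmax G × NoIsolated G ×
  (∀ lo hi → EndIn G lo → EndIn G hi → ∃[ z ] Interval G lo hi z →
     (H : OT) → ∃[ f ] CopyIn F H (Interval G lo hi) f)

Splitting : {k : ℕ} → (Fin k → Branch) → List ℕ → Set
Splitting f s =
  ∃[ i ] ∃[ j ] (restrict (f i) (length s) ≡ s × restrict (f j) (length s) ≡ s
                 × f i (length s) ≢ f j (length s))

-- the induced substructure of F_t on succ_{T_I}(t) is isomorphic to H:
-- succ nodes t⌢a are identified with their last coordinate a.
CarriesCopy : Strω → (H : OT) → (Fin (size H) → Branch) → List ℕ → Set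
CarriesCopy F H f t =
  Σ (Fin (size H) → ℕ) λ g →
    (∀ i j → i <ᶠ j → g i < g j) ×
    (∀ i j → R H i j ⇔ FtR F (length t) (g i) (g j)) ×
    (∀ a → (∃[ i ] (restrict (f i) (length t) ≡ t × f i (length t) ≡ a)) ⇔ (∃[ j ] (g j ≡ a)))

-- Extend H by a new minimum and a new maximum whose edges to the other
-- vertices alternate in direction along the order. In a copy inside F_max all
-- branches agree below the meet level ℓ of the two extreme branches, so
-- the only candidate splitting node is their common restriction to ℓ. At
-- level ℓ the edge between two branches is read off F_ℓ from their ℓ-th
-- coordinates; if two neighbours shared that coordinate, every vertex sitting
-- at another coordinate would see them alike. One of the two extreme vertices
-- always sits at another coordinate, and by construction it orients its edges
-- to any two neighbours differently, so the ℓ-th coordinates are pairwise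
-- distinct: the stem is the only splitting node and its successors carry the
-- copy.
module Submission where

open import Defs
open import Data.Empty using (⊥; ⊥-elim)
open import Data.Fin using (Fin; zero; suc; toℕ; fromℕ; fromℕ<; inject₁)
  renaming (_<_ to _<ᶠ_; _≤_ to _≤ᶠ_)
open import Data.Fin.Properties using (toℕ-injective; toℕ-fromℕ; toℕ-fromℕ<; toℕ-inject₁; toℕ<n; ≤fromℕ)
  renaming (_≟_ to _≟ᶠ_; <-cmp to <ᶠ-cmp)
open import Data.Fin.Relation.Unary.Top using (View; view; ‵fromℕ; ‵inj₁; view-fromℕ; view-inject₁)
open import Data.List using (List; upTo; applyUpTo; length)
open import Data.List.Properties using (length-map; length-upTo; map-upTo; map-cong-local; ∷-injective)
open import Data.List.Relation.Unary.All.Properties using (applyUpTo⁺₁)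
open import Data.Nat using (ℕ; zero; suc; _≤_; _<_; _≟_; z≤n; s≤s; parity)
open import Data.Nat.Properties
  using (<-cmp; <-irrefl; <⇒≢; <⇒≤; ≤-reflexive; ≤-antisym; ≤-trans; ≤-<-trans; ≤∧≢⇒<; m≤n⇒m<n∨m≡n; n≤1+n; 1+n≢0; ≮⇒≥)
open import Data.Parity using (0ℙ; 1ℙ; _⁻¹)
open import Data.Parity.Properties using (p≢p⁻¹; suc-homo-⁻¹; ⁻¹-involutive)
open import Data.Product using (Σ; ∃-syntax; _×_; _,_; proj₁; proj₂)
open import Data.Sum using (_⊎_; inj₁; inj₂; swap)
open import Data.Unit using (⊤; tt)
open import Relation.Binary.Definitions using (tri<; tri≈; tri>)
open import Relation.Binary.PropositionalEquality
  using (_≡_; _≢_; refl; sym; trans; cong; subst; module ≡-Reasoning)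
open import Relation.Nullary using (¬_; yes; no; contradiction)

⇔-refl : ∀ {A : Set} → A ⇔ A
⇔-refl = (λ a → a) , (λ a → a)

⇔-sym : ∀ {A B : Set} → A ⇔ B → B ⇔ A
⇔-sym (to , from) = from , to

⇔-trans : ∀ {A B C : Set} → A ⇔ B → B ⇔ C → A ⇔ C
⇔-trans (to₁ , from₁) (to₂ , from₂) = (λ a → to₂ (to₁ a)) , (λ c → from₁ (from₂ c))

parity-suc : ∀ m → parity (suc m) ≡ parity m ⁻¹
parity-suc m = begin
  parity (suc m)         ≡⟨ sym (⁻¹-involutive (parity (suc m))) ⟩
  parity (suc m) ⁻¹ ⁻¹   ≡⟨ cong _⁻¹ (suc-homo-⁻¹ m) ⟩
  parity m ⁻¹            ∎
  where open ≡-Reasoning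

≡p⊎≡p⁻¹ : ∀ q p → q ≡ p ⊎ q ≡ p ⁻¹
≡p⊎≡p⁻¹ 0ℙ 0ℙ = inj₁ refl
≡p⊎≡p⁻¹ 0ℙ 1ℙ = inj₂ refl
≡p⊎≡p⁻¹ 1ℙ 0ℙ = inj₂ refl
≡p⊎≡p⁻¹ 1ℙ 1ℙ = inj₁ refl

≡p⇒≢p⁻¹ : ∀ {q p} → q ≡ p → q ≢ p ⁻¹
≡p⇒≢p⁻¹ {p = p} q≡p q≡p⁻¹ = p≢p⁻¹ p (trans (sym q≡p) q≡p⁻¹)

parity-alternates : ∀ m p → ¬ (parity m ≡ p ⇔ parity (suc m) ≡ p)
parity-alternates m p (to , from) with ≡p⊎≡p⁻¹ (parity m) p
... | inj₁ m≡p  = ≡p⇒≢p⁻¹ (to m≡p) (trans (parity-suc m) (cong _⁻¹ m≡p))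
... | inj₂ m≡p⁻¹ = ≡p⇒≢p⁻¹ (from (trans (parity-suc m) (trans (cong _⁻¹ m≡p⁻¹) (⁻¹-involutive p)))) m≡p⁻¹

AgreeBelow-sym : ∀ {x y n} → AgreeBelow x y n → AgreeBelow y x n
AgreeBelow-sym x≈y k k<n = sym (x≈y k k<n)

AgreeBelow-trans : ∀ {x y z n} → AgreeBelow x y n → AgreeBelow y z n → AgreeBelow x z n
AgreeBelow-trans x≈y y≈z k k<n = trans (x≈y k k<n) (y≈z k k<n)

AgreeBelow-mono : ∀ {x y m n} → n ≤ m → AgreeBelow x y m → AgreeBelow x y n
AgreeBelow-mono n≤m x≈y k k<n = x≈y k (≤-trans k<n n≤m)

MeetAt-unique : ∀ {x y m n} → MeetAt x y m → MeetAt x y n → m ≡ n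
MeetAt-unique {m = m} {n} (x≈ₘy , xₘ≢yₘ) (x≈ₙy , xₙ≢yₙ) with <-cmp m n
... | tri< m<n _ _ = contradiction (x≈ₙy m m<n) xₘ≢yₘ
... | tri≈ _ m≡n _ = m≡n
... | tri> _ _ n<m = contradiction (x≈ₘy n n<m) xₙ≢yₙ

<L⇒≤-at : ∀ {x y n} → x <L y → AgreeBelow x y n → x n ≤ y n
<L⇒≤-at {n = n} (m , x≈y , xₘ<yₘ) x≈ₙy with <-cmp m n
... | tri< m<n _ _  = contradiction (x≈ₙy m m<n) (<⇒≢ xₘ<yₘ)
... | tri≈ _ refl _ = <⇒≤ xₘ<yₘ
... | tri> _ _ n<m  = ≤-reflexive (x≈y n n<m)

<L-between : ∀ {x y z n} → x <L y → y <L z → AgreeBelow x z n → AgreeBelow x y n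
<L-between {x} {y} {z} {n} (m₁ , x≈y , x<y) (m₂ , y≈z , y<z) x≈z =
  AgreeBelow-mono (≮⇒≥ m₁≮n) x≈y
  where
  m₁≮n : ¬ m₁ < n
  m₁≮n m₁<n with <-cmp m₁ m₂
  ... | tri< m₁<m₂ _ _ = <-irrefl (trans (x≈z m₁ m₁<n) (sym (y≈z m₁ m₁<m₂))) x<y
  ... | tri≈ _ refl _  = <-irrefl (x≈z m₁ m₁<n) (≤-trans x<y (<⇒≤ y<z))
  ... | tri> _ _ m₂<m₁ = <-irrefl (trans (sym (x≈y m₂ m₂<m₁)) (x≈z m₂ (≤-<-trans (<⇒≤ m₂<m₁) m₁<n))) y<z

length-restrict : ∀ x n → length (restrict x n) ≡ n
length-restrict x n = trans (length-map x (upTo n)) (length-upTo n)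

restrict-cong : ∀ {x y} n → AgreeBelow x y n → restrict x n ≡ restrict y n
restrict-cong n x≈y = map-cong-local (applyUpTo⁺₁ (λ k → k) n (λ {k} → x≈y k))

applyUpTo-≡⇒AgreeBelow : ∀ (x y : Branch) n → applyUpTo x n ≡ applyUpTo y n → AgreeBelow x y n
applyUpTo-≡⇒AgreeBelow x y (suc n) eq zero    _         = proj₁ (∷-injective eq)
applyUpTo-≡⇒AgreeBelow x y (suc n) eq (suc k) (s≤s k<n) =
  applyUpTo-≡⇒AgreeBelow (λ i → x (suc i)) (λ i → y (suc i)) n (proj₂ (∷-injective eq)) k k<n

restrict-≡⇒AgreeBelow : ∀ x y n → restrict x n ≡ restrict y n → AgreeBelow x y n
restrict-≡⇒AgreeBelow x y n eq =
  applyUpTo-≡⇒AgreeBelow x y n (trans (sym (map-upTo x n)) (trans eq (map-upTo y n)))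

FtR-irrefl : ∀ F → (∀ x → ¬ Rω F x x) → ∀ m a → ¬ FtR F m a a
FtR-irrefl F Rω-irrefl m a (σ , _ , a' , b' , a'≡a , b'≡a , r)
  with toℕ-injective {i = a'} {j = b'} (trans a'≡a (sym b'≡a))
... | refl = Rω-irrefl (toℕ (σ a')) r

Separates : (K : OT) → Fin (size K) → Fin (size K) → Fin (size K) → Set
Separates K k a b = ¬ (R K k a ⇔ R K k b)

EndsSeparateNeighbours : (K : OT) → Fin (size K) → Fin (size K) → Set
EndsSeparateNeighbours K lo hi = ∀ a b → toℕ b ≡ suc (toℕ a) →
  (a ≢ lo → Separates K lo a b) × (b ≢ hi → Separates K hi a b)

module CopyInFmax (F : Strω) (K : OT) (f : Fin (size K) → Branch)
  (increasing : ∀ i j → i <ᶠ j → f i <L f j)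
  (related : ∀ i j → R K i j ⇔ FmaxR F (f i) (f j))
  (lo hi : Fin (size K)) (lo≤ : ∀ (i : Fin (size K)) → lo ≤ᶠ i) (≤hi : ∀ (i : Fin (size K)) → i ≤ᶠ hi)
  (lo<hi : lo <ᶠ hi) where

  level : ℕ
  level = proj₁ (increasing lo hi lo<hi)

  label : Fin (size K) → ℕ
  label i = f i level

  agree-lo-hi : AgreeBelow (f lo) (f hi) level
  agree-lo-hi = proj₁ (proj₂ (increasing lo hi lo<hi))

  label-lo<label-hi : label lo < label hi
  label-lo<label-hi = proj₂ (proj₂ (increasing lo hi lo<hi))

  agree-lo : ∀ i → AgreeBelow (f lo) (f i) level
  agree-lo i with m≤n⇒m<n∨m≡n (lo≤ i) | m≤n⇒m<n∨m≡n (≤hi i)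
  ... | inj₂ lo≡i | _         = subst (λ j → AgreeBelow (f lo) (f j) level) (toℕ-injective lo≡i) (λ _ _ → refl)
  ... | inj₁ _    | inj₂ i≡hi = subst (λ j → AgreeBelow (f lo) (f j) level) (toℕ-injective (sym i≡hi)) agree-lo-hi
  ... | inj₁ lo<i | inj₁ i<hi = <L-between (increasing lo i lo<i) (increasing i hi i<hi) agree-lo-hi

  agree : ∀ i j → AgreeBelow (f i) (f j) level
  agree i j = AgreeBelow-trans (AgreeBelow-sym (agree-lo i)) (agree-lo j)

  label-mono : ∀ {i j} → i ≤ᶠ j → label i ≤ label j
  label-mono {i} {j} i≤j with m≤n⇒m<n∨m≡n i≤j
  ... | inj₁ i<j = <L⇒≤-at (increasing i j i<j) (agree i j)
  ... | inj₂ i≡j = ≤-reflexive (cong label (toℕ-injective i≡j))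

  meet-at-level : ∀ {a b} → label a ≢ label b → MeetAt (f a) (f b) level
  meet-at-level {a} {b} ne = agree a b , ne

  FmaxR⇔FtR-at-level : ∀ {a b} → label a ≢ label b → FmaxR F (f a) (f b) ⇔ FtR F level (label a) (label b)
  FmaxR⇔FtR-at-level {a} {b} ne =
    (λ (m , meet , r) → subst (λ m → FtR F m (f a m) (f b m)) (MeetAt-unique meet (meet-at-level ne)) r) ,
    (λ r → level , meet-at-level ne , r)

  R⇔FtR-at-level : ∀ {a b} → label a ≢ label b → R K a b ⇔ FtR F level (label a) (label b)
  R⇔FtR-at-level {a} {b} ne = ⇔-trans (related a b) (FmaxR⇔FtR-at-level ne)

  related-invisible : ∀ {k a b} → label k ≢ label a → label a ≡ label b → R K k a ⇔ R K k b
  related-invisible {k} {a} {b} k≢a a≡b =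
    ⇔-trans (subst (λ l → R K k a ⇔ FtR F level (label k) l) a≡b (R⇔FtR-at-level k≢a))
            (⇔-sym (R⇔FtR-at-level k≢b))
    where
    k≢b : label k ≢ label b
    k≢b k≡b = k≢a (trans k≡b (sym a≡b))

  increasing-label : Injective label → ∀ i j → i <ᶠ j → label i < label j
  increasing-label label-inj i j i<j =
    ≤∧≢⇒< (label-mono (<⇒≤ i<j)) (λ li≡lj → <⇒≢ i<j (cong toℕ (label-inj i j li≡lj)))

  stem : List ℕ
  stem = restrict (f lo) level

  restrict-level : ∀ i → restrict (f i) level ≡ stem
  restrict-level i = restrict-cong level (AgreeBelow-sym (agree-lo i))

  stem-splits : Splitting f stem
  stem-splits rewrite length-restrict (f lo) level =
    lo , hi , refl , restrict-level hi , <⇒≢ label-lo<label-hi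

  splitting-unique : Injective label → ∀ t → Splitting f t → t ≡ stem
  splitting-unique label-inj t (i , j , fi↾≡t , fj↾≡t , fi≢fj) = begin
    t                            ≡⟨ sym fi↾≡t ⟩
    restrict (f i) (length t)    ≡⟨ cong (restrict (f i)) |t|≡level ⟩
    restrict (f i) level         ≡⟨ restrict-level i ⟩
    stem                         ∎
    where
    open ≡-Reasoning
    i≢j : label i ≢ label j
    i≢j i≡j = fi≢fj (cong (λ k → f k (length t)) (label-inj i j i≡j))
    meet : MeetAt (f i) (f j) (length t)
    meet = restrict-≡⇒AgreeBelow (f i) (f j) (length t) (trans fi↾≡t (sym fj↾≡t)) , fi≢fj
    |t|≡level : length t ≡ level
    |t|≡level = MeetAt-unique meet (meet-at-level i≢j)

  stem-carries : (∀ x → ¬ Rω F x x) → Injective label → CarriesCopy F K f stem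
  stem-carries Rω-irrefl label-inj rewrite length-restrict (f lo) level =
    label , increasing-label label-inj , related-label ,
    λ a → (λ (i , _ , fi≡a) → i , fi≡a) , (λ (j , fj≡a) → j , restrict-level j , fj≡a)
    where
    related-label : ∀ i j → R K i j ⇔ FtR F level (label i) (label j)
    related-label i j with i ≟ᶠ j
    ... | yes refl = (λ r → ⊥-elim (irrefl K i r)) , (λ r → ⊥-elim (FtR-irrefl F Rω-irrefl level (label i) r))
    ... | no i≢j = R⇔FtR-at-level (λ li≡lj → i≢j (label-inj i j li≡lj))

  module _ (separate : EndsSeparateNeighbours K lo hi) where

    neighbours-label-distinct : ∀ {a b} → toℕ b ≡ suc (toℕ a) → label a ≢ label b
    neighbours-label-distinct {a} {b} b≡a+1 a≡b with label lo ≟ label a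
    ... | no lo≢a = proj₁ (separate a b b≡a+1) (λ a≡lo → lo≢a (cong label (sym a≡lo))) (related-invisible lo≢a a≡b)
    ... | yes lo≡a = proj₂ (separate a b b≡a+1) (λ b≡hi → hi≢a (trans (cong label (sym b≡hi)) (sym a≡b)))
                       (related-invisible hi≢a a≡b)
      where
      hi≢a : label hi ≢ label a
      hi≢a hi≡a = <⇒≢ label-lo<label-hi (trans lo≡a (sym hi≡a))

    -- Monotonicity squeezes a label collision onto a pair of neighbours.
    label-distinct-< : ∀ {i j} → i <ᶠ j → label i ≢ label j
    label-distinct-< {i} {j} i<j li≡lj = neighbours-label-distinct {i} {next} toℕ-next li≡lnext
      where
      next<size : suc (toℕ i) < size K
      next<size = ≤-<-trans i<j (toℕ<n j)
      next : Fin (size K)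
      next = fromℕ< next<size
      toℕ-next : toℕ next ≡ suc (toℕ i)
      toℕ-next = toℕ-fromℕ< next<size
      li≡lnext : label i ≡ label next
      li≡lnext = ≤-antisym (label-mono (subst (toℕ i ≤_) (sym toℕ-next) (n≤1+n (toℕ i))))
                         (subst (label next ≤_) (sym li≡lj) (label-mono (subst (_≤ toℕ j) (sym toℕ-next) i<j)))

    label-injective : Injective label
    label-injective i j li≡lj with <ᶠ-cmp i j
    ... | tri< i<j _ _ = contradiction li≡lj (label-distinct-< i<j)
    ... | tri≈ _ i≡j _ = i≡j
    ... | tri> _ _ j<i = contradiction (sym li≡lj) (label-distinct-< j<i)

data Slot (n : ℕ) : Set where
  low  : Slot n
  mid  : Fin n → Slot n
  high : Slot n

module _ {n : ℕ} where

  index : Slot n → Fin (suc (suc n))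
  index low     = zero
  index (mid i) = suc (inject₁ i)
  index high    = fromℕ (suc n)

  slot-suc : {j : Fin (suc n)} → View j → Slot n
  slot-suc ‵fromℕ             = high
  slot-suc (‵inj₁ {i = i} _) = mid i

  slot : Fin (suc (suc n)) → Slot n
  slot zero    = low
  slot (suc j) = slot-suc (view j)

  index-slot-suc : {j : Fin (suc n)} (v : View j) → index (slot-suc v) ≡ suc j
  index-slot-suc ‵fromℕ    = refl
  index-slot-suc (‵inj₁ _) = refl

  index-slot : ∀ a → index (slot a) ≡ a
  index-slot zero    = refl
  index-slot (suc j) = index-slot-suc (view j)

  slot-index : ∀ s → slot (index s) ≡ s
  slot-index low     = refl
  slot-index (mid i) rewrite view-inject₁ i = refl
  slot-index high    rewrite view-fromℕ n = refl

module Extension (H : OT) where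

  n : ℕ
  n = size H

  -- x and y are the positions of the two vertices in H̄: low → b iff b has the
  -- parity of the position suc n of high, and b → high iff b is even; hence the
  -- edge low → high is consistent with both rules.
  edge : Slot n → Slot n → ℕ → ℕ → Set
  edge low     low     _ _ = ⊥
  edge low     (mid _) _ y = parity y ≡ parity (suc n)
  edge low     high    _ _ = ⊤
  edge (mid _) low     x _ = parity x ≡ parity (suc n) ⁻¹
  edge (mid i) (mid j) _ _ = R H i j
  edge (mid _) high    x _ = parity x ≡ 0ℙ
  edge high    low     _ _ = ⊥
  edge high    (mid _) _ y = parity y ≡ 1ℙ
  edge high    high    _ _ = ⊥

  edge-irrefl : ∀ s x → ¬ edge s s x x
  edge-irrefl (mid i) x = irrefl H i

  edge-asym : ∀ s t x y → edge s t x y → ¬ edge t s y x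
  edge-asym low     (mid _) x y = ≡p⇒≢p⁻¹
  edge-asym (mid _) low     x y = λ x≡p⁻¹ x≡p → ≡p⇒≢p⁻¹ x≡p x≡p⁻¹
  edge-asym (mid i) (mid j) x y = asym H i j
  edge-asym (mid _) high    x y = ≡p⇒≢p⁻¹
  edge-asym high    (mid _) x y = λ y≡1 y≡0 → ≡p⇒≢p⁻¹ y≡0 y≡1

  edge-total : ∀ s t x y → s ≢ t → edge s t x y ⊎ edge t s y x
  edge-total low     low     x y s≢t = contradiction refl s≢t
  edge-total low     (mid _) x y _   = ≡p⊎≡p⁻¹ (parity y) (parity (suc n))
  edge-total low     high    x y _   = inj₁ tt
  edge-total (mid _) low     x y _   = swap (≡p⊎≡p⁻¹ (parity x) (parity (suc n)))
  edge-total (mid i) (mid j) x y s≢t = total H i j (λ i≡j → s≢t (cong mid i≡j))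
  edge-total (mid _) high    x y _   = ≡p⊎≡p⁻¹ (parity x) 0ℙ
  edge-total high    low     x y _   = inj₂ tt
  edge-total high    (mid _) x y _   = swap (≡p⊎≡p⁻¹ (parity y) 0ℙ)
  edge-total high    high    x y s≢t = contradiction refl s≢t

  H̄ : OT
  H̄ = record
    { size   = suc (suc n)
    ; R      = λ a b → edge (slot a) (slot b) (toℕ a) (toℕ b)
    ; irrefl = λ a → edge-irrefl (slot a) (toℕ a)
    ; asym   = λ a b → edge-asym (slot a) (slot b) (toℕ a) (toℕ b)
    ; total  = λ a b a≢b → edge-total (slot a) (slot b) (toℕ a) (toℕ b)
                 (λ sa≡sb → a≢b (trans (sym (index-slot a)) (trans (cong index sa≡sb) (index-slot b))))
    }

  highest : Fin (suc (suc n))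
  highest = index high

  embed : Fin n → Fin (suc (suc n))
  embed i = index (mid i)

  embed-isEmbedding : IsEmbedding H H̄ embed
  embed-isEmbedding = increasing , related
    where
    increasing : ∀ i j → i <ᶠ j → embed i <ᶠ embed j
    increasing i j i<j rewrite toℕ-inject₁ i | toℕ-inject₁ j = s≤s i<j
    related : ∀ i j → R H i j ⇔ R H̄ (embed i) (embed j)
    related i j rewrite slot-index (mid i) | slot-index (mid j) = ⇔-refl

  row-lowest : ∀ b → b ≢ zero → R H̄ zero b ⇔ (parity (toℕ b) ≡ parity (suc n))
  row-lowest b b≢0 with slot b | index-slot b
  ... | low   | refl = contradiction refl b≢0
  ... | mid _ | refl = ⇔-refl
  ... | high  | refl rewrite toℕ-fromℕ (suc n) = (λ _ → refl) , (λ _ → tt)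

  row-highest : ∀ b → b ≢ highest → R H̄ highest b ⇔ (parity (toℕ b) ≡ 1ℙ)
  row-highest b b≢hi rewrite slot-index (high {n}) with slot b | index-slot b
  ... | low   | refl = (λ ()) , (λ ())
  ... | mid _ | refl = ⇔-refl
  ... | high  | refl = contradiction refl b≢hi

  separated-by-parity : ∀ {k a b p} → toℕ b ≡ suc (toℕ a) →
    R H̄ k a ⇔ (parity (toℕ a) ≡ p) → R H̄ k b ⇔ (parity (toℕ b) ≡ p) → Separates H̄ k a b
  separated-by-parity {k} {a} {b} {p} b≡a+1 row-a row-b a⇔b =
    parity-alternates (toℕ a) p
      (⇔-trans (⇔-sym row-a) (⇔-trans a⇔b (subst (λ m → R H̄ k b ⇔ (parity m ≡ p)) b≡a+1 row-b)))

  ends-separate : EndsSeparateNeighbours H̄ zero highest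
  ends-separate a b b≡a+1 =
    (λ a≢0 → separated-by-parity {k = zero} b≡a+1 (row-lowest a a≢0) (row-lowest b b≢0)) ,
    (λ b≢hi → separated-by-parity {k = highest} b≡a+1 (row-highest a a≢hi) (row-highest b b≢hi))
    where
    b≢0 : b ≢ zero
    b≢0 b≡0 = 1+n≢0 (trans (sym b≡a+1) (cong toℕ b≡0))
    a≢hi : a ≢ highest
    a≢hi a≡hi = <-irrefl (trans b≡a+1 (cong suc (trans (cong toℕ a≡hi) (toℕ-fromℕ (suc n))))) (toℕ<n b)

lemma6p4 : (F : Strω) → IsFlimOT F → (H : OT) →
    Σ OT λ Hb →
      (∃[ e ] IsEmbedding H Hb e) ×
      ((G : Branch → Set) → UniversalILS F G →
        (f : Fin (size Hb) → Branch) → CopyIn F Hb G f →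
        Σ (List ℕ) λ t →
          Splitting f t × (∀ t' → Splitting f t' → t' ≡ t) × CarriesCopy F Hb f t)
lemma6p4 F (_ , _ , _ , Rω-irrefl , _) H =
  H̄ , (embed , embed-isEmbedding) , λ G _ f (_ , increasing , related) →
    let open CopyInFmax F H̄ f increasing related zero highest (λ _ → z≤n) ≤fromℕ (s≤s z≤n)
        label-inj = label-injective ends-separate
    in stem , stem-splits , splitting-unique label-inj , stem-carries Rω-irrefl label-inj
  where open Extension H
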